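{- Let $A$ be a diversified formula of $\mathcal{L}_{\wedge,\vee}$, let $B$ be a subformula of $A$, and suppose $\mathit{let}A\setminus\mathit{let}B=\{p_1,\ldots,p_n\}$ (with $n\geq 0$; the set is empty if $n=0$). Then there is a sequence $S_1,\ldots,S_n$ with each $S_i\in\{\top,\bot\}$ such that $A^{p_1\ldots p_n}_{S_1\ldots S_n}\leftrightarrow B$ is a tautology of classical propositional logic.
   Context: $\mathcal{L}$ is the propositional language generated from an infinite set of propositional letters by the nullary connectives $\top,\bot$, the unary connective $\neg$ and the binary connectives $\wedge,\vee$; $\leftrightarrow$ and $\rightarrow$ are the usual defined (material) equivalence and implication. $\mathcal{L}_{\wedge,\vee}$ is the sublanguage built from letters using only $\wedge$ and $\vee$. A formula is diversified when every letter occurs in it at most once. $\mathit{let}A$ denotes the set of letters occurring in $A$. $A^{p_1\ldots p_n}_{S_1\ldots S_n}$ denotes the result of simultaneously substituting $S_i$ for every occurrence of $p_i$ in $A$. Tautology means classical tautology. -}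

module Defs where

open import Data.Nat using (ℕ; _≟_)
open import Data.Bool using (Bool; true; false; _∧_; _∨_; not; if_then_else_)
open import Data.List using (List; []; _∷_; _++_)
open import Data.List.Membership.DecPropositional _≟_ using (_∈_; _∈?_)
open import Data.List.Relation.Unary.Unique.Propositional using (Unique)
open import Relation.Nullary using (¬_)
open import Relation.Nullary.Decidable using (⌊_⌋)
open import Relation.Binary.PropositionalEquality using (_≡_)

data Fm : Set where
  var  : ℕ → Fm
  ⊤'   : Fm
  ⊥'   : Fm
  ¬'_  : Fm → Fm
  _∧'_ : Fm → Fm → Fm
  _∨'_ : Fm → Fm → Fm

data InAV : Fm → Set where
  var : ∀ p → InAV (var p)
  and : ∀ {A B} → InAV A → InAV B → InAV (A ∧' B)
  or  : ∀ {A B} → InAV A → InAV B → InAV (A ∨' B)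

occ : Fm → List ℕ
occ (var p)  = p ∷ []
occ ⊤'       = []
occ ⊥'       = []
occ (¬' A)   = occ A
occ (A ∧' B) = occ A ++ occ B
occ (A ∨' B) = occ A ++ occ B

_∈let_ : ℕ → Fm → Set
p ∈let A = p ∈ occ A

Diversified : Fm → Set
Diversified A = Unique (occ A)

data _⊑_ : Fm → Fm → Set where
  refl  : ∀ {A} → A ⊑ A
  neg   : ∀ {B A} → B ⊑ A → B ⊑ (¬' A)
  andL  : ∀ {B A C} → B ⊑ A → B ⊑ (A ∧' C)
  andR  : ∀ {B A C} → B ⊑ C → B ⊑ (A ∧' C)
  orL   : ∀ {B A C} → B ⊑ A → B ⊑ (A ∨' C)
  orR   : ∀ {B A C} → B ⊑ C → B ⊑ (A ∨' C)

eval : (ℕ → Bool) → Fm → Bool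
eval v (var p)  = v p
eval v ⊤'       = true
eval v ⊥'       = false
eval v (¬' A)   = not (eval v A)
eval v (A ∧' B) = eval v A ∧ eval v B
eval v (A ∨' B) = eval v A ∨ eval v B

Taut↔ : Fm → Fm → Set
Taut↔ A B = ∀ (v : ℕ → Bool) → eval v A ≡ eval v B

constFm : Bool → Fm
constFm true  = ⊤'
constFm false = ⊥'

-- Simultaneous substitution: each letter p of A that is not a letter of B
-- is replaced by the constant S p ∈ {⊤, ⊥}; letters of B are kept.
substOut : Fm → (ℕ → Bool) → Fm → Fm
substOut B S (var p)  = if ⌊ p ∈? occ B ⌋ then var p else constFm (S p)
substOut B S ⊤'       = ⊤'
substOut B S ⊥'       = ⊥'
substOut B S (¬' A)   = ¬' substOut B S A
substOut B S (A ∧' C) = substOut B S A ∧' substOut B S C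
substOut B S (A ∨' C) = substOut B S A ∨' substOut B S C

-- Induction along the path from A down to B. Each time the path enters one side of a
-- conjunction (disjunction), set every letter of the other side to ⊤ (⊥): by idempotence
-- of ∧ and ∨ that side becomes ⊤ (⊥), the neutral element, so the connective vanishes.
-- Diversity makes the letters of the frozen side disjoint from those on the path, so
-- these choices never conflict with one another nor touch the letters of B.
module Submission where

open import Defs
open import Function using (id; _∘′_)
open import Data.Nat using (ℕ; _≟_)
open import Data.Bool using (Bool; true; false; _∧_; _∨_; if_then_else_)
open import Data.Bool.Properties using (∧-idem; ∨-idem; ∧-identityʳ; ∨-identityʳ)
open import Data.Product using (∃; _×_; _,_)
open import Data.List using (List; []; _∷_; _++_)
open import Data.List.Membership.DecPropositional _≟_ using (_∈_; _∉_; _∈?_)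
open import Data.List.Membership.Propositional.Properties using (∈-++⁺ˡ; ∈-++⁺ʳ)
open import Data.List.Relation.Unary.Any using (here; there)
open import Data.List.Relation.Unary.All as All using ()
open import Data.List.Relation.Unary.All.Properties as All using ()
open import Data.List.Relation.Unary.AllPairs using (_∷_)
open import Data.List.Relation.Unary.Unique.Propositional using (Unique; [])
open import Data.List.Relation.Binary.Subset.Propositional using (_⊆_)
open import Data.List.Relation.Binary.Disjoint.Propositional using (Disjoint)
open import Data.List.Relation.Binary.Disjoint.Setoid.Properties as Disjoint using ()
open import Relation.Binary.PropositionalEquality using (_≡_; refl; sym; trans; cong; cong₂; setoid)
open import Relation.Nullary using (yes; no; contradiction)
open import Relation.Nullary.Decidable using (⌊_⌋)

unique-++⁻ : ∀ xs {ys : List ℕ} → Unique (xs ++ ys) → Unique xs × Unique ys × Disjoint xs ys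
unique-++⁻ []       u = [] , u , λ ()
unique-++⁻ (x ∷ xs) (x∉ ∷ u) with unique-++⁻ xs u
... | uxs , uys , xs#ys = All.++⁻ˡ xs x∉ ∷ uxs , uys , disjoint
  where
  disjoint : Disjoint (x ∷ xs) _
  disjoint (here refl , v∈ys) = All.lookup (All.++⁻ʳ xs x∉) v∈ys refl
  disjoint (there v∈xs , v∈ys) = xs#ys (v∈xs , v∈ys)

occ-⊑ : ∀ {B A} → B ⊑ A → occ B ⊆ occ A
occ-⊑ refl             = id
occ-⊑ (neg d)          = occ-⊑ d
occ-⊑ (andL d)         = ∈-++⁺ˡ ∘′ occ-⊑ d
occ-⊑ (andR {A = A} d) = ∈-++⁺ʳ (occ A) ∘′ occ-⊑ d
occ-⊑ (orL d)          = ∈-++⁺ˡ ∘′ occ-⊑ d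
occ-⊑ (orR {A = A} d)  = ∈-++⁺ʳ (occ A) ∘′ occ-⊑ d

overrideOn : List ℕ → Bool → (ℕ → Bool) → ℕ → Bool
overrideOn xs b S p = if ⌊ p ∈? xs ⌋ then b else S p

overrideOn-∈ : ∀ {xs b S p} → p ∈ xs → overrideOn xs b S p ≡ b
overrideOn-∈ {xs} {p = p} p∈ with p ∈? xs
... | yes _ = refl
... | no p∉ = contradiction p∈ p∉

overrideOn-∉ : ∀ {xs b S p} → p ∉ xs → overrideOn xs b S p ≡ S p
overrideOn-∉ {xs} {p = p} p∉ with p ∈? xs
... | yes p∈ = contradiction p∈ p∉
... | no _   = refl

substOut-cong : ∀ B {S S′} A → (∀ {p} → p ∈ occ A → S p ≡ S′ p) → substOut B S A ≡ substOut B S′ A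
substOut-cong B (var p)  S≗S′ = cong (if ⌊ p ∈? occ B ⌋ then var p else_) (cong constFm (S≗S′ (here refl)))
substOut-cong B ⊤'       S≗S′ = refl
substOut-cong B ⊥'       S≗S′ = refl
substOut-cong B (¬' A)   S≗S′ = cong ¬'_ (substOut-cong B A S≗S′)
substOut-cong B (A ∧' C) S≗S′ =
  cong₂ _∧'_ (substOut-cong B A (S≗S′ ∘′ ∈-++⁺ˡ)) (substOut-cong B C (S≗S′ ∘′ ∈-++⁺ʳ (occ A)))
substOut-cong B (A ∨' C) S≗S′ =
  cong₂ _∨'_ (substOut-cong B A (S≗S′ ∘′ ∈-++⁺ˡ)) (substOut-cong B C (S≗S′ ∘′ ∈-++⁺ʳ (occ A)))

substOut-id : ∀ B {S} A → occ A ⊆ occ B → substOut B S A ≡ A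
substOut-id B (var p) A⊆B with p ∈? occ B
... | yes _  = refl
... | no p∉B = contradiction (A⊆B (here refl)) p∉B
substOut-id B ⊤'       A⊆B = refl
substOut-id B ⊥'       A⊆B = refl
substOut-id B (¬' A)   A⊆B = cong ¬'_ (substOut-id B A A⊆B)
substOut-id B (A ∧' C) A⊆B =
  cong₂ _∧'_ (substOut-id B A (A⊆B ∘′ ∈-++⁺ˡ)) (substOut-id B C (A⊆B ∘′ ∈-++⁺ʳ (occ A)))
substOut-id B (A ∨' C) A⊆B =
  cong₂ _∨'_ (substOut-id B A (A⊆B ∘′ ∈-++⁺ˡ)) (substOut-id B C (A⊆B ∘′ ∈-++⁺ʳ (occ A)))

eval-substOut-const : ∀ B {S b C} v → InAV C → (∀ {p} → p ∈ occ C → p ∉ occ B) →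
  (∀ {p} → p ∈ occ C → S p ≡ b) → eval v (substOut B S C) ≡ b
eval-substOut-const B {S} {b} v (var p) C∌B S≡b with p ∈? occ B
... | yes p∈B = contradiction p∈B (C∌B (here refl))
... | no _    = trans (cong (eval v ∘′ constFm) (S≡b (here refl))) (eval-constFm b)
  where
  eval-constFm : ∀ b → eval v (constFm b) ≡ b
  eval-constFm true  = refl
  eval-constFm false = refl
eval-substOut-const B {b = b} v (and {A} iA iC) C∌B S≡b = trans
  (cong₂ _∧_ (eval-substOut-const B v iA (C∌B ∘′ ∈-++⁺ˡ) (S≡b ∘′ ∈-++⁺ˡ))
             (eval-substOut-const B v iC (C∌B ∘′ ∈-++⁺ʳ (occ A)) (S≡b ∘′ ∈-++⁺ʳ (occ A))))
  (∧-idem b)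
eval-substOut-const B {b = b} v (or {A} iA iC) C∌B S≡b = trans
  (cong₂ _∨_ (eval-substOut-const B v iA (C∌B ∘′ ∈-++⁺ˡ) (S≡b ∘′ ∈-++⁺ˡ))
             (eval-substOut-const B v iC (C∌B ∘′ ∈-++⁺ʳ (occ A)) (S≡b ∘′ ∈-++⁺ʳ (occ A))))
  (∨-idem b)

freeze-sibling : ∀ {A B C S} b → InAV C → Disjoint (occ A) (occ C) → B ⊑ A →
  Taut↔ (substOut B S A) B →
  let S′ = overrideOn (occ C) b S in
  Taut↔ (substOut B S′ A) B × (∀ v → eval v (substOut B S′ C) ≡ b)
freeze-sibling {A} {B} {C} {S} b iC A#C B⊑A taut =
  (λ v → trans (cong (eval v) (sym (substOut-cong B A S≗S′))) (taut v)) ,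
  (λ v → eval-substOut-const B v iC (λ p∈C p∈B → A#C (occ-⊑ B⊑A p∈B , p∈C)) (overrideOn-∈ {occ C} {b} {S}))
  where
  S≗S′ : ∀ {p} → p ∈ occ A → S p ≡ overrideOn (occ C) b S p
  S≗S′ p∈A = sym (overrideOn-∉ {occ C} {b} {S} (λ p∈C → A#C (p∈A , p∈C)))

lemma1 : (A B : Fm) → InAV A → Diversified A → B ⊑ A →
    ∃ λ (S : ℕ → Bool) → Taut↔ (substOut B S A) B
lemma1 A .A _ _ refl = (λ _ → true) , λ v → cong (eval v) (substOut-id A A id)
lemma1 _ _ () _ (neg _)
lemma1 (A ∧' C) B (and iA iC) u (andL B⊑A) =
  let uA , _ , A#C = unique-++⁻ (occ A) u
      S , taut = lemma1 A B iA uA B⊑A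
      tautA , C≡⊤ = freeze-sibling true iC A#C B⊑A taut
  in  overrideOn (occ C) true S , λ v → trans (cong₂ _∧_ (tautA v) (C≡⊤ v)) (∧-identityʳ _)
lemma1 (A ∧' C) B (and iA iC) u (andR B⊑C) =
  let _ , uC , A#C = unique-++⁻ (occ A) u
      S , taut = lemma1 C B iC uC B⊑C
      tautC , A≡⊤ = freeze-sibling true iA (Disjoint.sym (setoid ℕ) A#C) B⊑C taut
  in  overrideOn (occ A) true S , λ v → cong₂ _∧_ (A≡⊤ v) (tautC v)
lemma1 (A ∨' C) B (or iA iC) u (orL B⊑A) =
  let uA , _ , A#C = unique-++⁻ (occ A) u
      S , taut = lemma1 A B iA uA B⊑A
      tautA , C≡⊥ = freeze-sibling false iC A#C B⊑A taut
  in  overrideOn (occ C) false S , λ v → trans (cong₂ _∨_ (tautA v) (C≡⊥ v)) (∨-identityʳ _)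
lemma1 (A ∨' C) B (or iA iC) u (orR B⊑C) =
  let _ , uC , A#C = unique-++⁻ (occ A) u
      S , taut = lemma1 C B iC uC B⊑C
      tautC , A≡⊥ = freeze-sibling false iA (Disjoint.sym (setoid ℕ) A#C) B⊑C taut
  in  overrideOn (occ A) false S , λ v → cong₂ _∨_ (A≡⊥ v) (tautC v)
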